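{- Let $B\colon\mathsf{Set}\to\mathsf{Set}$ be polynomial with final coalgebra $(B_\omega,\zeta)$ and let $F\colon\mathsf{Set}\to\mathsf{Set}$ be a functor. An algebra $\alpha_\omega\colon FB_\omega\to B_\omega$ is causal if and only if it is definable by a distributive law.
   Context: $B$ polynomial: isomorphic to $X\mapsto\coprod_{a\in I}X^{E_a}$ for some family of sets. Final sequence: $B_0=1$, $B_{i+1}=BB_i$, $B_j=\lim_{i<j}B_i$ at limit $j$, connecting maps $B_{j,i}$; $B_\omega$ carries the final coalgebra. $\alpha\colon FB_\omega\to B_\omega$ is causal if for every set $X$, all $f,g\colon X\to B_\omega$ and $i<\omega$, $B_{\omega,i}\circ f=B_{\omega,i}\circ g$ implies $B_{\omega,i}\circ\alpha\circ Ff=B_{\omega,i}\circ\alpha\circ Fg$. An algebra $\alpha\colon FZ\to Z$ on the final coalgebra $(Z,\zeta)$ is definable by a distributive law if there exist a functor $G$, a natural transformation $\lambda\colon GB\Rightarrow BG$ with induced algebra $\beta\colon GZ\to Z$ (the unique map with $\zeta\circ\beta=B\beta\circ\lambda_Z\circ G\zeta$), and a natural transformation $\kappa\colon F\Rightarrow G$ with $\alpha=\beta\circ\kappa_Z$. -}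

module Defs where

open import Level using (0ℓ)
open import Data.Nat using (ℕ; zero; suc)
open import Data.Unit using (⊤; tt)
open import Data.Product using (Σ; _,_; _×_; Σ-syntax)
open import Function using (_∘_; id)
open import Relation.Binary.PropositionalEquality using (_≡_; refl)

-- Endofunctors on Set (laws stated pointwise; the theorem assumes funext).
record Functor : Set₁ where
  field
    F₀     : Set → Set
    fmap   : {A B : Set} → (A → B) → F₀ A → F₀ B
    fmap-id : {A : Set} (x : F₀ A) → fmap id x ≡ x
    fmap-∘  : {A B C : Set} (f : A → B) (g : B → C) (x : F₀ A) →
              fmap (g ∘ f) x ≡ fmap g (fmap f x)
open Functor public

record NatTrans (F G : Functor) : Set₁ where
  field
    η       : (X : Set) → F₀ F X → F₀ G X
    natural : {X Y : Set} (f : X → Y) (x : F₀ F X) →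
              η Y (fmap F f x) ≡ fmap G f (η X x)
open NatTrans public

record DistLaw (G B : Functor) : Set₁ where
  field
    lam     : (X : Set) → F₀ G (F₀ B X) → F₀ B (F₀ G X)
    natural : {X Y : Set} (f : X → Y) (x : F₀ G (F₀ B X)) →
              lam Y (fmap G (fmap B f) x) ≡ fmap B (fmap G f) (lam X x)
open DistLaw public

-- Polynomial functor X ↦ ∐_{a ∈ I} X^{E a}.
record Polynomial : Set₁ where
  field
    I : Set
    E : I → Set
open Polynomial public

PolyF : Polynomial → Functor
PolyF P = record
  { F₀ = λ X → Σ (I P) (λ a → E P a → X)
  ; fmap = λ { f (a , h) → (a , f ∘ h) }
  ; fmap-id = λ _ → refl
  ; fmap-∘ = λ _ _ _ → refl
  }

module _ (P : Polynomial) where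
  private B = PolyF P

  Bseq : ℕ → Set
  Bseq zero    = ⊤
  Bseq (suc n) = F₀ B (Bseq n)

  conn : (n : ℕ) → Bseq (suc n) → Bseq n
  conn zero    _ = tt
  conn (suc n)   = fmap B (conn n)

  Bω : Set
  Bω = Σ ((n : ℕ) → Bseq n) (λ s → (n : ℕ) → conn n (s (suc n)) ≡ s n)

  πω : (i : ℕ) → Bω → Bseq i
  πω i (s , _) = s i

  -- ζ : B_ω → B B_ω is the canonical final-coalgebra structure on the limit,
  -- i.e. the (unique) map with B(B_{ω,i}) ∘ ζ = B_{ω,i+1} for all i.
  IsCanonicalζ : (Bω → F₀ B Bω) → Set
  IsCanonicalζ ζ = (i : ℕ) (x : Bω) → fmap B (πω i) (ζ x) ≡ πω (suc i) x

  Causal : (F : Functor) → (F₀ F Bω → Bω) → Set₁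
  Causal F α = (X : Set) (f g : X → Bω) (i : ℕ) →
    ((x : X) → πω i (f x) ≡ πω i (g x)) →
    (y : F₀ F X) → πω i (α (fmap F f y)) ≡ πω i (α (fmap F g y))

  InducedBy : (ζ : Bω → F₀ B Bω) (G : Functor) (l : DistLaw G B) →
              (F₀ G Bω → Bω) → Set
  InducedBy ζ G l β = (x : F₀ G Bω) →
    ζ (β x) ≡ fmap B β (lam l Bω (fmap G ζ x))

  DefinableByDistLaw : (ζ : Bω → F₀ B Bω) (F : Functor) →
                       (F₀ F Bω → Bω) → Set₁
  DefinableByDistLaw ζ F α =
    Σ[ G ∈ Functor ] Σ[ l ∈ DistLaw G B ] Σ[ κ ∈ NatTrans F G ]
    Σ[ β ∈ (F₀ G Bω → Bω) ]
      ( InducedBy ζ G l β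
      × ((β' : F₀ G Bω → Bω) → InducedBy ζ G l β' → (x : F₀ G Bω) → β' x ≡ β x)
      × ((x : F₀ F Bω) → α x ≡ β (η κ Bω x)) )

module Submission where

-- (⇐) An algebra β induced by λ : GB ⇒ BG is causal by induction on the depth i:
-- if f and g agree to depth i+1, then ζ∘f and ζ∘g factor as Bf'∘k and Bg'∘k
-- with f', g' agreeing to depth i ('split'), and the defining equation of β
-- together with naturality of λ reduces depth i+1 of β to depth i.  Causality
-- then transfers from β to α = β∘κ along the natural transformation κ.
--
-- (⇒) A causal α is determined by level maps αₙ : F Bₙ → Bₙ compatible with
-- the connecting maps.  The functor G X consists of "probes": an input
-- y : F(Bⁿ X), the depth-n shape t = αₙ(F trunc y) of its output, and a
-- position p in t.  The law λ reads the shape of the output node at p from one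
-- level deeper and sends each child direction to the extended probe.  The map
-- "subtree of α(F join y) at p" is a coalgebra morphism from λ∘Gζ to ζ, so by
-- finality it is the induced algebra β, and at depth 0 it is α itself.

open import Defs
open import Level using (0ℓ)
open import Function.Bundles using (_⇔_; mk⇔)
open import Axiom.Extensionality.Propositional using (Extensionality)
open import Axiom.UniquenessOfIdentityProofs.WithK using (uip)
open import Data.Nat using (ℕ; zero; suc)
open import Data.Unit using (⊤; tt)
open import Data.Product using (Σ; _,_; proj₁; proj₂)
open import Function using (_∘_)
open import Relation.Binary.PropositionalEquality
  using (_≡_; refl; sym; trans; cong; subst; module ≡-Reasoning)
open import Relation.Binary.PropositionalEquality.Properties using (subst-subst)

subst-irrelevant : {A : Set} (Pr : A → Set) {x y z : A}
  (q : x ≡ y) (r : y ≡ z) (s : x ≡ z) (v : Pr x) →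
  subst Pr r (subst Pr q v) ≡ subst Pr s v
subst-irrelevant Pr q r s v =
  trans (subst-subst {P = Pr} q) (cong (λ w → subst Pr w v) (uip (trans q r) s))

causal-along : (P : Polynomial) (F G : Functor)
  (α : F₀ F (Bω P) → Bω P) (β : F₀ G (Bω P) → Bω P) (κ : NatTrans F G) →
  ((x : F₀ F (Bω P)) → α x ≡ β (η κ (Bω P) x)) →
  Causal P G β → Causal P F α
causal-along P F G α β κ α≡βκ β-causal X f g i agree y = begin
  πω P i (α (fmap F f y))            ≡⟨ via f ⟩
  πω P i (β (fmap G f (η κ X y)))    ≡⟨ β-causal X f g i agree (η κ X y) ⟩
  πω P i (β (fmap G g (η κ X y)))    ≡⟨ sym (via g) ⟩
  πω P i (α (fmap F g y))            ∎
  where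
  open ≡-Reasoning
  via : (h : X → Bω P) → πω P i (α (fmap F h y)) ≡ πω P i (β (fmap G h (η κ X y)))
  via h = cong (πω P i) (trans (α≡βκ (fmap F h y)) (cong β (natural κ h y)))

module Trees (fe : Extensionality 0ℓ 0ℓ) (P : Polynomial) where

  BX : Set → Set
  BX X = Σ (I P) (λ a → E P a → X)

  bmap : {X Y : Set} → (X → Y) → BX X → BX Y
  bmap f u = proj₁ u , λ e → f (proj₂ u e)

  Ω : Set
  Ω = Bω P

  Bs : ℕ → Set
  Bs = Bseq P

  π : (i : ℕ) → Ω → Bs i
  π = πω P

  cn : (n : ℕ) → Bs (suc n) → Bs n
  cn = conn P

  Ω-ext : {x y : Ω} → ((i : ℕ) → π i x ≡ π i y) → x ≡ y
  Ω-ext {s , c} {s' , c'} same with fe same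
  ... | refl = cong (s ,_) (fe λ n → uip (c n) (c' n))

  B-≡ : {Z : Set} {a a' : I P} (s : a ≡ a') {f : E P a → Z} {g : E P a' → Z} →
    ((e : E P a) → f e ≡ g (subst (E P) s e)) → _≡_ {A = BX Z} (a , f) (a' , g)
  B-≡ {a = a} refl same = cong (a ,_) (fe same)

  B-children : {Z : Set} {u v : BX Z} → u ≡ v → {a : I P}
    (s : a ≡ proj₁ u) (s' : a ≡ proj₁ v) (e : E P a) →
    proj₂ u (subst (E P) s e) ≡ proj₂ v (subst (E P) s' e)
  B-children {u = u} refl s s' e = cong (λ w → proj₂ u (subst (E P) w e)) (uip s s')

  BΩ-ext : {u v : BX Ω} → ((i : ℕ) → bmap (π i) u ≡ bmap (π i) v) → u ≡ v
  BΩ-ext {a , h} {b , h'} same = B-≡ shape λ e → Ω-ext λ i → B-children (same i) refl shape e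
    where
    shape : a ≡ b
    shape = cong proj₁ (same 0)

  Bⁿ : ℕ → Set → Set
  Bⁿ zero    X = X
  Bⁿ (suc n) X = BX (Bⁿ n X)

  Bⁿmap : (n : ℕ) {X Y : Set} → (X → Y) → Bⁿ n X → Bⁿ n Y
  Bⁿmap zero    f = f
  Bⁿmap (suc n) f = bmap (Bⁿmap n f)

  Bⁿmap-id : (n : ℕ) {X : Set} (w : Bⁿ n X) → Bⁿmap n (λ x → x) w ≡ w
  Bⁿmap-id zero    w       = refl
  Bⁿmap-id (suc n) (a , h) = cong (a ,_) (fe λ e → Bⁿmap-id n (h e))

  Bⁿmap-∘ : (n : ℕ) {X Y Z : Set} (f : X → Y) (g : Y → Z) (w : Bⁿ n X) →
    Bⁿmap n (g ∘ f) w ≡ Bⁿmap n g (Bⁿmap n f w)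
  Bⁿmap-∘ zero    f g w       = refl
  Bⁿmap-∘ (suc n) f g (a , h) = cong (a ,_) (fe λ e → Bⁿmap-∘ n f g (h e))

  trunc : (n : ℕ) {X : Set} → Bⁿ n X → Bs n
  trunc zero    w       = tt
  trunc (suc n) (a , h) = a , λ e → trunc n (h e)

  trunc-nat : (n : ℕ) {X Y : Set} (f : X → Y) (w : Bⁿ n X) → trunc n (Bⁿmap n f w) ≡ trunc n w
  trunc-nat zero    f w       = refl
  trunc-nat (suc n) f (a , h) = cong (a ,_) (fe λ e → trunc-nat n f (h e))

  -- Bⁿ(B X) is B^{n+1} X, read with the extra layer at the bottom.
  shift : (n : ℕ) {X : Set} → Bⁿ n (BX X) → Bⁿ (suc n) X
  shift zero    w       = w
  shift (suc n) (a , h) = a , λ e → shift n (h e)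

  shift-nat : (n : ℕ) {X Y : Set} (f : X → Y) (w : Bⁿ n (BX X)) →
    shift n (Bⁿmap n (bmap f) w) ≡ Bⁿmap (suc n) f (shift n w)
  shift-nat zero    f w       = refl
  shift-nat (suc n) f (a , h) = cong (a ,_) (fe λ e → shift-nat n f (h e))

  trunc-shift : (n : ℕ) {X : Set} (w : Bⁿ n (BX X)) → cn n (trunc (suc n) (shift n w)) ≡ trunc n w
  trunc-shift zero    w       = refl
  trunc-shift (suc n) (a , h) = cong (a ,_) (fe λ e → trunc-shift n (h e))

  Path : (n : ℕ) → Bs n → Set
  Path zero    _       = ⊤
  Path (suc n) (a , g) = Σ (E P a) (λ e → Path n (g e))

  node : (n : ℕ) (T : Bs (suc n)) → Path n (cn n T) → I P
  node zero    (a , g) _       = a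
  node (suc n) (a , g) (e , p) = node n (g e) p

  snoc : (n : ℕ) (T : Bs (suc n)) (p : Path n (cn n T)) → E P (node n T p) → Path (suc n) T
  snoc zero    (a , g) _        e = e , tt
  snoc (suc n) (a , g) (e₀ , p) e = e₀ , snoc n (g e₀) p e

  Path-transport : (n : ℕ) (a : I P) (f g : E P a → Bs n) (q : _≡_ {A = Bs (suc n)} (a , f) (a , g))
    (e : E P a) (p : Path n (f e)) (r : f e ≡ g e) →
    subst (Path (suc n)) q (e , p) ≡ (e , subst (Path n) r p)
  Path-transport n a f .f refl e p refl = refl

  -- Completing a depth-k shape by constant a-trees below depth k: all levels.
  fill : I P → (k : ℕ) → Bs k → (m : ℕ) → Bs m
  fill a zero    t       zero    = tt
  fill a zero    t       (suc m) = a , λ _ → fill a zero t m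
  fill a (suc k) _       zero    = tt
  fill a (suc k) (b , h) (suc m) = b , λ e → fill a k (h e) m

  fill-coherent : (a : I P) (k : ℕ) (t : Bs k) (m : ℕ) → cn m (fill a k t (suc m)) ≡ fill a k t m
  fill-coherent a zero    t       zero    = refl
  fill-coherent a zero    t       (suc m) = cong (a ,_) (fe λ _ → fill-coherent a zero t m)
  fill-coherent a (suc k) _       zero    = refl
  fill-coherent a (suc k) (b , h) (suc m) = cong (b ,_) (fe λ e → fill-coherent a k (h e) m)

  fill-agrees : (a : I P) (k : ℕ) (t : Bs k) → fill a k t k ≡ t
  fill-agrees a zero    t       = refl
  fill-agrees a (suc k) (b , h) = cong (b ,_) (fe λ e → fill-agrees a k (h e))

  section : (k : ℕ) → Bs (suc k) → Ω
  section k T = fill (proj₁ T) (suc k) T , fill-coherent (proj₁ T) (suc k) T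

  π-section : (k : ℕ) (T : Bs (suc k)) → π (suc k) (section k T) ≡ T
  π-section k T = fill-agrees (proj₁ T) (suc k) T

  module WithZeta (ζ : Ω → BX Ω) (isC : IsCanonicalζ P ζ) where

    module Unfold {C : Set} (c : C → BX C) where
      approx : (m : ℕ) → C → Bs m
      approx zero    x = tt
      approx (suc m) x = bmap (approx m) (c x)

      approx-coherent : (m : ℕ) (x : C) → cn m (approx (suc m) x) ≡ approx m x
      approx-coherent zero    x = refl
      approx-coherent (suc m) x = cong (proj₁ (c x) ,_) (fe λ e → approx-coherent m (proj₂ (c x) e))

      unfold : C → Ω
      unfold x = (λ m → approx m x) , λ m → approx-coherent m x

      unfold-hom : (x : C) → ζ (unfold x) ≡ bmap unfold (c x)
      unfold-hom x = BΩ-ext λ i → isC i (unfold x)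

      unfold-unique : (h : C → Ω) → ((x : C) → ζ (h x) ≡ bmap h (c x)) → (x : C) → h x ≡ unfold x
      unfold-unique h hom x = Ω-ext λ i → levels i x
        where
        levels : (i : ℕ) (x : C) → π i (h x) ≡ approx i x
        levels zero    x = refl
        levels (suc i) x = trans (sym (isC i (h x)))
          (trans (cong (bmap (π i)) (hom x)) (cong (proj₁ (c x) ,_) (fe λ e → levels i (proj₂ (c x) e))))

    cons-levels : BX Ω → (m : ℕ) → Bs m
    cons-levels u zero    = tt
    cons-levels u (suc m) = bmap (π m) u

    cons-coherent : (u : BX Ω) (m : ℕ) → cn m (cons-levels u (suc m)) ≡ cons-levels u m
    cons-coherent u zero    = refl
    cons-coherent u (suc m) = cong (proj₁ u ,_) (fe λ e → proj₂ (proj₂ u e) m)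

    cons : BX Ω → Ω
    cons u = cons-levels u , cons-coherent u

    cons-ζ : (x : Ω) → cons (ζ x) ≡ x
    cons-ζ x = Ω-ext λ { zero → refl ; (suc i) → isC i x }

    join : (n : ℕ) → Bⁿ n Ω → Ω
    join zero    w = w
    join (suc n) w = cons (bmap (join n) w)

    π-join : (n : ℕ) (w : Bⁿ n Ω) → π n (join n w) ≡ trunc n w
    π-join zero    w       = refl
    π-join (suc n) (a , h) = cong (a ,_) (fe λ e → π-join n (h e))

    join-shift-cons : (n : ℕ) (v : Bⁿ n (BX Ω)) → join (suc n) (shift n v) ≡ join n (Bⁿmap n cons v)
    join-shift-cons zero    v       = refl
    join-shift-cons (suc n) (a , h) = cong (λ z → cons (a , z)) (fe λ e → join-shift-cons n (h e))

    join-shift : (n : ℕ) (w : Bⁿ n Ω) → join (suc n) (shift n (Bⁿmap n ζ w)) ≡ join n w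
    join-shift n w = begin
      join (suc n) (shift n (Bⁿmap n ζ w))  ≡⟨ join-shift-cons n (Bⁿmap n ζ w) ⟩
      join n (Bⁿmap n cons (Bⁿmap n ζ w))   ≡⟨ cong (join n) (sym (Bⁿmap-∘ n ζ cons w)) ⟩
      join n (Bⁿmap n (cons ∘ ζ) w)         ≡⟨ cong (λ h → join n (Bⁿmap n h w)) (fe cons-ζ) ⟩
      join n (Bⁿmap n (λ x → x) w)          ≡⟨ cong (join n) (Bⁿmap-id n w) ⟩
      join n w                              ∎
      where open ≡-Reasoning

    subtree : (n : ℕ) (W : Ω) → Path n (π n W) → Ω
    subtree-child : (n : ℕ) (u : BX Ω) → Path (suc n) (bmap (π n) u) → Ω
    subtree zero    W _ = W
    subtree (suc n) W p = subtree-child n (ζ W) (subst (Path (suc n)) (sym (isC n W)) p)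
    subtree-child n u (e , p) = subtree n (proj₂ u e) p

    subtree-cong : (n : ℕ) {W W' : Ω} → W ≡ W' → {t : Bs n} (c : t ≡ π n W) (c' : t ≡ π n W')
      (p : Path n t) → subtree n W (subst (Path n) c p) ≡ subtree n W' (subst (Path n) c' p)
    subtree-cong n refl c c' p = cong (λ w → subtree n _ (subst (Path n) w p)) (uip c c')

    subtree-step : (n : ℕ) (W : Ω) (c : cn (suc n) (bmap (π (suc n)) (ζ W)) ≡ π (suc n) W)
      (e₀ : E P (proj₁ (ζ W))) (p : Path n (cn n (π (suc n) (proj₂ (ζ W) e₀)))) →
      subtree (suc n) W (subst (Path (suc n)) c (e₀ , p))
        ≡ subtree n (proj₂ (ζ W) e₀) (subst (Path n) (proj₂ (proj₂ (ζ W) e₀) n) p)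
    subtree-step n W c e₀ p = cong (subtree-child n (ζ W))
      (trans (subst-subst {P = Path (suc n)} c)
        (Path-transport n (proj₁ (ζ W)) _ _ (trans c (sym (isC n W))) e₀ p (proj₂ (proj₂ (ζ W) e₀) n)))

    node-agrees : (n : ℕ) (W : Ω) (T : Bs (suc n)) → bmap (π n) (ζ W) ≡ T →
      (c : cn n T ≡ π n W) (p : Path n (cn n T)) →
      node n T p ≡ proj₁ (ζ (subtree n W (subst (Path n) c p)))
    node-agrees zero    W _ refl c p        = refl
    node-agrees (suc n) W _ refl c (e₀ , p) =
      trans (node-agrees n child _ (isC n child) (proj₂ child n) p)
            (cong (proj₁ ∘ ζ) (sym (subtree-step n W c e₀ p)))
      where
      child : Ω
      child = proj₂ (ζ W) e₀

    child-agrees : (n : ℕ) (W : Ω) (T : Bs (suc n)) → bmap (π n) (ζ W) ≡ T →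
      (c : cn n T ≡ π n W) (d : T ≡ π (suc n) W) (p : Path n (cn n T))
      (s : node n T p ≡ proj₁ (ζ (subtree n W (subst (Path n) c p)))) (e : E P (node n T p)) →
      subtree (suc n) W (subst (Path (suc n)) d (snoc n T p e))
        ≡ proj₂ (ζ (subtree n W (subst (Path n) c p))) (subst (E P) s e)
    child-agrees zero W _ refl c d p s e =
      trans (cong (subtree-child 0 (ζ W)) (subst-irrelevant (Path 1) d (sym (isC 0 W)) refl (e , tt)))
            (B-children {u = ζ W} refl refl s e)
    child-agrees (suc n) W _ refl c d (e₀ , p) s e = begin
      subtree (suc (suc n)) W (subst (Path (suc (suc n))) d (e₀ , snoc n T p e))
        ≡⟨ cong (subtree-child (suc n) (ζ W))
             (subst-irrelevant (Path (suc (suc n))) d (sym (isC (suc n) W)) refl (e₀ , snoc n T p e)) ⟩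
      subtree (suc n) child (snoc n T p e)
        ≡⟨ child-agrees n child T (isC n child) (proj₂ child n) refl p s' e ⟩
      proj₂ (ζ (subtree n child (subst (Path n) (proj₂ child n) p))) (subst (E P) s' e)
        ≡⟨ B-children (cong ζ (sym (subtree-step n W c e₀ p))) s' s e ⟩
      proj₂ (ζ (subtree (suc n) W (subst (Path (suc n)) c (e₀ , p)))) (subst (E P) s e)
        ∎
      where
      open ≡-Reasoning
      child : Ω
      child = proj₂ (ζ W) e₀
      T : Bs (suc n)
      T = π (suc n) child
      s' : node n T p ≡ proj₁ (ζ (subtree n child (subst (Path n) (proj₂ child n) p)))
      s' = node-agrees n child T (isC n child) (proj₂ child n) p

    record Split {X : Set} (i : ℕ) (f g : X → Ω) : Set₁ where
      field
        Y       : Set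
        k       : X → BX Y
        f' g'   : Y → Ω
        f-split : (x : X) → ζ (f x) ≡ bmap f' (k x)
        g-split : (x : X) → ζ (g x) ≡ bmap g' (k x)
        agree   : (y : Y) → π i (f' y) ≡ π i (g' y)

    split : {X : Set} (i : ℕ) (f g : X → Ω) →
      ((x : X) → π (suc i) (f x) ≡ π (suc i) (g x)) → Split i f g
    split {X} i f g agree₊ = record
      { Y = Y ; k = k ; f' = f' ; g' = g'
      ; f-split = λ x → refl
      ; g-split = λ x → sym (B-≡ (shape x) λ e → refl)
      ; agree = λ { (x , e) → B-children (top x) refl (shape x) e }
      }
      where
      Y : Set
      Y = Σ X (λ x → E P (proj₁ (ζ (f x))))
      k : X → BX Y
      k x = proj₁ (ζ (f x)) , λ e → x , e
      top : (x : X) → bmap (π i) (ζ (f x)) ≡ bmap (π i) (ζ (g x))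
      top x = trans (isC i (f x)) (trans (agree₊ x) (sym (isC i (g x))))
      shape : (x : X) → proj₁ (ζ (f x)) ≡ proj₁ (ζ (g x))
      shape x = cong proj₁ (top x)
      f' g' : Y → Ω
      f' (x , e) = proj₂ (ζ (f x)) e
      g' (x , e) = proj₂ (ζ (g x)) (subst (E P) (shape x) e)

    induced-step : (G : Functor) (l : DistLaw G (PolyF P)) (β : F₀ G Ω → Ω) → InducedBy P ζ G l β →
      {X Y : Set} (f : X → Ω) (k : X → BX Y) (f' : Y → Ω) → ((x : X) → ζ (f x) ≡ bmap f' (k x)) →
      (i : ℕ) (w : F₀ G X) →
      π (suc i) (β (fmap G f w)) ≡ bmap (λ z → π i (β (fmap G f' z))) (lam l Y (fmap G k w))
    induced-step G l β induced {X} {Y} f k f' factor i w = begin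
      π (suc i) (β (fmap G f w))
        ≡⟨ sym (isC i (β (fmap G f w))) ⟩
      bmap (π i) (ζ (β (fmap G f w)))
        ≡⟨ cong (bmap (π i)) (induced (fmap G f w)) ⟩
      bmap (π i ∘ β) (lam l Ω (fmap G ζ (fmap G f w)))
        ≡⟨ cong (bmap (π i ∘ β) ∘ lam l Ω) regroup ⟩
      bmap (π i ∘ β) (lam l Ω (fmap G (bmap f') (fmap G k w)))
        ≡⟨ cong (bmap (π i ∘ β)) (natural l f' (fmap G k w)) ⟩
      bmap (λ z → π i (β (fmap G f' z))) (lam l Y (fmap G k w))
        ∎
      where
      open ≡-Reasoning
      regroup : fmap G ζ (fmap G f w) ≡ fmap G (bmap f') (fmap G k w)
      regroup = trans (sym (fmap-∘ G f ζ w))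
        (trans (cong (λ h → fmap G h w) (fe factor)) (fmap-∘ G k (bmap f') w))

    induced-causal : (G : Functor) (l : DistLaw G (PolyF P)) (β : F₀ G Ω → Ω) →
      InducedBy P ζ G l β → Causal P G β
    induced-causal G l β induced X f g zero    agree₊ w = refl
    induced-causal G l β induced X f g (suc i) agree₊ w = begin
      π (suc i) (β (fmap G f w))
        ≡⟨ induced-step G l β induced f k f' f-split i w ⟩
      bmap (λ z → π i (β (fmap G f' z))) (lam l Y (fmap G k w))
        ≡⟨ cong (_ ,_) (fe λ e → induced-causal G l β induced Y f' g' i agree (proj₂ (lam l Y (fmap G k w)) e)) ⟩
      bmap (λ z → π i (β (fmap G g' z))) (lam l Y (fmap G k w))
        ≡⟨ sym (induced-step G l β induced g k g' g-split i w) ⟩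
      π (suc i) (β (fmap G g w))
        ∎
      where
      open ≡-Reasoning
      open Split (split i f g agree₊)

    module Forward (F : Functor) (α : F₀ F Ω → Ω) (causal : Causal P F α) where

      Fm : {X Y : Set} → (X → Y) → F₀ F X → F₀ F Y
      Fm = fmap F

      F-cong : {X Y : Set} {f g : X → Y} → ((x : X) → f x ≡ g x) → (y : F₀ F X) → Fm f y ≡ Fm g y
      F-cong same y = cong (λ h → Fm h y) (fe same)

      αₙ : (k : ℕ) → F₀ F (Bs k) → Bs k
      αₙ zero    z = tt
      αₙ (suc k) z = π (suc k) (α (Fm (section k) z))

      αₙ-approximates : {X : Set} (f : X → Ω) (k : ℕ) (z : F₀ F X) →
        αₙ k (Fm (π k ∘ f) z) ≡ π k (α (Fm f z))
      αₙ-approximates f zero    z = refl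
      αₙ-approximates {X} f (suc k) z =
        trans (cong (π (suc k) ∘ α) (sym (fmap-∘ F (π (suc k) ∘ f) (section k) z)))
              (causal X (section k ∘ π (suc k) ∘ f) f (suc k) (λ x → π-section k (π (suc k) (f x))) z)

      αₙ-coherent : (k : ℕ) (Z : F₀ F (Bs (suc k))) → cn k (αₙ (suc k) Z) ≡ αₙ k (Fm (cn k) Z)
      αₙ-coherent k Z = trans (proj₂ (α (Fm (section k) Z)) k)
        (sym (trans (cong (αₙ k) (F-cong level Z)) (αₙ-approximates (section k) k Z)))
        where
        level : (T : Bs (suc k)) → cn k T ≡ π k (section k T)
        level T = trans (cong (cn k) (sym (π-section k T))) (proj₂ (section k T) k)

      αₙ-join : (n : ℕ) (y : F₀ F (Bⁿ n Ω)) → αₙ n (Fm (trunc n) y) ≡ π n (α (Fm (join n) y))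
      αₙ-join n y = trans (cong (αₙ n) (F-cong (λ w → sym (π-join n w)) y)) (αₙ-approximates (join n) n y)

      F-trunc-nat : (n : ℕ) {X Y : Set} (f : X → Y) (y : F₀ F (Bⁿ n X)) →
        Fm (trunc n) (Fm (Bⁿmap n f) y) ≡ Fm (trunc n) y
      F-trunc-nat n f y = trans (sym (fmap-∘ F (Bⁿmap n f) (trunc n) y)) (F-cong (trunc-nat n f) y)

      F-trunc-shift : (n : ℕ) {X : Set} (y : F₀ F (Bⁿ n (BX X))) →
        Fm (cn n) (Fm (trunc (suc n)) (Fm (shift n) y)) ≡ Fm (trunc n) y
      F-trunc-shift n y = trans (sym (fmap-∘ F (trunc (suc n)) (cn n) _))
        (trans (sym (fmap-∘ F (shift n) (cn n ∘ trunc (suc n)) y)) (F-cong (trunc-shift n) y))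

      record Probe (X : Set) : Set where
        constructor probe
        field
          depth    : ℕ
          input    : F₀ F (Bⁿ depth X)
          shape    : Bs depth
          computes : αₙ depth (Fm (trunc depth) input) ≡ shape
          position : Path depth shape

      probe-≡ : {X : Set} (n : ℕ) {y y' : F₀ F (Bⁿ n X)} → y ≡ y' → (t : Bs n)
        (q : αₙ n (Fm (trunc n) y) ≡ t) (q' : αₙ n (Fm (trunc n) y') ≡ t) (p : Path n t) →
        probe n y t q p ≡ probe n y' t q' p
      probe-≡ n refl t q q' p = cong (λ r → probe n _ t r p) (uip q q')

      mapProbe : {X Y : Set} → (X → Y) → Probe X → Probe Y
      mapProbe f (probe n y t q p) = probe n (Fm (Bⁿmap n f) y) t (trans (cong (αₙ n) (F-trunc-nat n f y)) q) p

      G : Functor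
      G = record
        { F₀      = Probe
        ; fmap    = mapProbe
        ; fmap-id = λ { (probe n y t q p) →
            probe-≡ n (trans (F-cong (Bⁿmap-id n) y) (fmap-id F y)) t _ q p }
        ; fmap-∘  = λ { f g (probe n y t q p) →
            probe-≡ n (trans (F-cong (Bⁿmap-∘ n f g) y) (fmap-∘ F (Bⁿmap n f) (Bⁿmap n g) y)) t _ _ p }
        }

      descend : {X : Set} (n : ℕ) (y₁ : F₀ F (Bⁿ (suc n) X)) (t₁ : Bs (suc n)) →
        αₙ (suc n) (Fm (trunc (suc n)) y₁) ≡ t₁ → (t : Bs n) → cn n t₁ ≡ t → Path n t → BX (Probe X)
      descend n y₁ t₁ q₁ t c p =
        node n t₁ (subst (Path n) (sym c) p) ,
        λ e → probe (suc n) y₁ t₁ q₁ (snoc n t₁ (subst (Path n) (sym c) p) e)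

      descend-irrelevant : {X : Set} (n : ℕ) {y₁ y₁' : F₀ F (Bⁿ (suc n) X)} → y₁ ≡ y₁' →
        {t₁ t₁' : Bs (suc n)} → t₁ ≡ t₁' →
        (q₁ : αₙ (suc n) (Fm (trunc (suc n)) y₁) ≡ t₁) (q₁' : αₙ (suc n) (Fm (trunc (suc n)) y₁') ≡ t₁')
        (t : Bs n) (c : cn n t₁ ≡ t) (c' : cn n t₁' ≡ t) (p : Path n t) →
        descend n y₁ t₁ q₁ t c p ≡ descend n y₁' t₁' q₁' t c' p
      descend-irrelevant n refl refl q₁ q₁' t c c' p rewrite uip c c' | uip q₁ q₁' = refl

      lamProbe : (X : Set) → Probe (BX X) → BX (Probe X)
      lamProbe X (probe n y t q p) = descend n y₁ t₁ refl t coherent p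
        where
        y₁ : F₀ F (Bⁿ (suc n) X)
        y₁ = Fm (shift n) y
        t₁ : Bs (suc n)
        t₁ = αₙ (suc n) (Fm (trunc (suc n)) y₁)
        coherent : cn n t₁ ≡ t
        coherent = trans (αₙ-coherent n _) (trans (cong (αₙ n) (F-trunc-shift n y)) q)

      lamProbe-nat : {X Y : Set} (f : X → Y) (x : Probe (BX X)) →
        lamProbe Y (mapProbe (bmap f) x) ≡ bmap (mapProbe f) (lamProbe X x)
      lamProbe-nat f (probe n y t q p) = descend-irrelevant n shifted (cong (αₙ (suc n)) trunc-eq) _ _ t _ _ p
        where
        shifted : Fm (shift n) (Fm (Bⁿmap n (bmap f)) y) ≡ Fm (Bⁿmap (suc n) f) (Fm (shift n) y)
        shifted = trans (sym (fmap-∘ F _ _ y))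
          (trans (F-cong (shift-nat n f) y) (fmap-∘ F _ _ y))
        trunc-eq : Fm (trunc (suc n)) (Fm (shift n) (Fm (Bⁿmap n (bmap f)) y))
                 ≡ Fm (trunc (suc n)) (Fm (shift n) y)
        trunc-eq = trans (cong (Fm (trunc (suc n))) shifted) (F-trunc-nat (suc n) f (Fm (shift n) y))

      L : DistLaw G (PolyF P)
      L = record { lam = lamProbe ; natural = lamProbe-nat }

      κ : NatTrans F G
      κ = record
        { η       = λ X x → probe 0 x tt refl tt
        ; natural = λ f x → probe-≡ 0 refl tt _ _ tt }

      open Unfold (λ x → lamProbe Ω (mapProbe ζ x))

      output : Probe Ω → Ω
      output (probe n y _ _ _) = α (Fm (join n) y)

      output-shape : (x : Probe Ω) → Probe.shape x ≡ π (Probe.depth x) (output x)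
      output-shape (probe n y t q p) = trans (sym q) (αₙ-join n y)

      described : Probe Ω → Ω
      described x = subtree (Probe.depth x) (output x)
        (subst (Path (Probe.depth x)) (output-shape x) (Probe.position x))

      described-hom : (x : Probe Ω) → ζ (described x) ≡ bmap described (lamProbe Ω (mapProbe ζ x))
      described-hom x@(probe n y t q p) = sym (B-≡ root-agrees children-agree)
        where
        y₁ : F₀ F (Bⁿ (suc n) Ω)
        y₁ = Fm (shift n) (Fm (Bⁿmap n ζ) y)
        t₁ : Bs (suc n)
        t₁ = αₙ (suc n) (Fm (trunc (suc n)) y₁)
        d₁ : BX (Probe Ω)
        d₁ = lamProbe Ω (mapProbe ζ x)
        p₁ : Path n (cn n t₁)
        p₁ = subst (Path n) (sym _) p
        W : Ω
        W = output x
        -- the deeper probes describe subtrees of the same output point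
        same-output : α (Fm (join (suc n)) y₁) ≡ W
        same-output = cong α (trans (sym (fmap-∘ F (shift n) (join (suc n)) _))
          (trans (sym (fmap-∘ F (Bⁿmap n ζ) _ y)) (F-cong (join-shift n) y)))
        t₁-shape : t₁ ≡ π (suc n) W
        t₁-shape = trans (αₙ-join (suc n) y₁) (cong (π (suc n)) same-output)
        t₁-approx : bmap (π n) (ζ W) ≡ t₁
        t₁-approx = trans (isC n W) (sym t₁-shape)
        c₁ : cn n t₁ ≡ π n W
        c₁ = trans (cong (cn n) t₁-shape) (proj₂ W n)
        S≡ : subtree n W (subst (Path n) c₁ p₁) ≡ described x
        S≡ = cong (subtree n W) (subst-irrelevant (Path n) _ c₁ (output-shape x) p)
        root-agrees : node n t₁ p₁ ≡ proj₁ (ζ (described x))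
        root-agrees = trans (node-agrees n W t₁ t₁-approx c₁ p₁) (cong (proj₁ ∘ ζ) S≡)
        children-agree : (e : E P (node n t₁ p₁)) →
          described (proj₂ d₁ e) ≡ proj₂ (ζ (described x)) (subst (E P) root-agrees e)
        children-agree e = trans (subtree-cong (suc n) same-output _ t₁-shape (snoc n t₁ p₁ e))
          (trans (child-agrees n W t₁ t₁-approx c₁ t₁-shape p₁ (node-agrees n W t₁ t₁-approx c₁ p₁) e)
                 (B-children (cong ζ S≡) _ root-agrees e))

      definable : DefinableByDistLaw P ζ F α
      definable = G , L , κ , unfold , unfold-hom , unfold-unique , factors
        where
        factors : (x : F₀ F Ω) → α x ≡ unfold (η κ Ω x)
        factors x = trans (cong α (sym (fmap-id F x))) (unfold-unique described described-hom (η κ Ω x))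

corollary9p6 : Extensionality 0ℓ 0ℓ →
    (P : Polynomial) (F : Functor) (ζ : Bω P → F₀ (PolyF P) (Bω P)) →
    IsCanonicalζ P ζ → (α : F₀ F (Bω P) → Bω P) →
    Causal P F α ⇔ DefinableByDistLaw P ζ F α
corollary9p6 fe P F ζ isC α = mk⇔ definable from-law
  where
  open Trees fe P
  open WithZeta ζ isC
  open Forward F α using (definable)
  from-law : DefinableByDistLaw P ζ F α → Causal P F α
  from-law (G , l , κ , β , induced , _ , α≡βκ) =
    causal-along P F G α β κ α≡βκ (induced-causal G l β induced)
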